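{- Let $G$ be a 2-connected grid graph, $\phi\equiv2$, and $H\in S_\phi$. Suppose that no square face in $B(H)$ is flippable. Then every square face in $B(H)$ is either a critical boundary square or a corner boundary square.
   Context: A grid graph is a finite induced subgraph of $\mathbb{Z}^2$, embedded in the plane; a square face is a face bounded by a unit lattice square. $S_\phi$ ($\phi\equiv2$) is the set of spanning subgraphs in which every vertex has degree 2, i.e. partitions of the vertex set into disjoint cycles. $B(H)$ is the set of faces of $G$ whose boundary contains vertices from two or more distinct cycles of $H$. A square face $f$ is flippable (equivalently, locally maximal or minimal with respect to $H$) if $H$ contains exactly two opposite sides of $f$ and no other side of $f$. A square face $f$ is a critical boundary square if its four vertices lie on exactly two cycles $C,C'$ of $H$, two on each, the two vertices on $C$ are adjacent along $f$ (and so are the two on $C'$), and exactly one of the two sides of $f$ joining vertices of the same cycle belongs to $H$. A square face $f$ with vertices $v_1,v_2,v_3,v_4$ in cyclic order is a corner boundary square if $v_1$ lies on one cycle of $H$ and $v_2,v_3,v_4$ lie on a different cycle, and both sides $v_2v_3$ and $v_3v_4$ belong to $H$. -}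

module Defs where

open import Data.Integer using (ℤ; _+_; _-_; ∣_∣; +_)
open import Data.Nat using (ℕ) renaming (_+_ to _+ℕ_)
open import Data.Product using (_×_; ∃; ∃₂; _,_; proj₁; proj₂; Σ-syntax)
open import Data.Sum using (_⊎_)
open import Data.Unit using (⊤)
open import Data.Fin using (Fin; zero; suc)
open import Data.List using (List)
open import Data.List.Membership.Propositional using (_∈_)
open import Relation.Binary.PropositionalEquality using (_≡_; _≢_)
open import Relation.Nullary using (¬_)
open import Relation.Binary.Construct.Closure.ReflexiveTransitive using (Star)

Point : Set
Point = ℤ × ℤ

Adj : Point → Point → Set
Adj p q = ∣ proj₁ p - proj₁ q ∣ +ℕ ∣ proj₂ p - proj₂ q ∣ ≡ 1

-- A grid graph is the finite induced subgraph of ℤ² on a finite vertex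
-- set V (given as a list; duplicates are harmless).

GEdgeIn : List Point → (Point → Set) → Point → Point → Set
GEdgeIn V P a b = a ∈ V × b ∈ V × P a × P b × Adj a b

ConnectedOn : List Point → (Point → Set) → Set
ConnectedOn V P = ∀ u v → u ∈ V → v ∈ V → P u → P v → Star (GEdgeIn V P) u v

Connected : List Point → Set
Connected V = ConnectedOn V (λ _ → ⊤)

TwoConnected : List Point → Set
TwoConnected V =
  (Σ[ a ∈ Point ] Σ[ b ∈ Point ] Σ[ c ∈ Point ]
     (a ∈ V × b ∈ V × c ∈ V × a ≢ b × b ≢ c × a ≢ c))
  × Connected V
  × (∀ x → x ∈ V → ConnectedOn V (λ y → y ≢ x))

-- H ∈ S_φ with φ ≡ 2: a spanning subgraph of G (edge relation E) in which
-- every vertex of G has degree exactly 2.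
record TwoFactor (V : List Point) : Set₁ where
  field
    E     : Point → Point → Set
    E-sym : ∀ {u v} → E u v → E v u
    E-inG : ∀ {u v} → E u v → u ∈ V × v ∈ V × Adj u v
    deg2  : ∀ v → v ∈ V →
            ∃₂ λ a b → a ≢ b × E v a × E v b × (∀ c → E v c → c ≡ a ⊎ c ≡ b)
open TwoFactor public

-- Two vertices lie on the same cycle of H iff they are joined by a walk in H
-- (the components of a 2-regular finite graph are its cycles).
SameCycle : ∀ {V} → TwoFactor V → Point → Point → Set
SameCycle H = Star (E H)

corner : Point → Fin 4 → Point
corner (x , y) zero = (x , y)
corner (x , y) (suc zero) = (x + + 1 , y)
corner (x , y) (suc (suc zero)) = (x + + 1 , y + + 1)
corner (x , y) (suc (suc (suc zero))) = (x , y + + 1)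

-- The unit square at p is a (square) face of the grid graph G iff all four
-- corners are vertices of G (G is an induced subgraph of ℤ², so no vertex
-- or edge lies inside a unit square).
SquareFace : List Point → Point → Set
SquareFace V p = ∀ i → corner p i ∈ V

InB : ∀ {V} → TwoFactor V → Point → Set
InB H p = ∃₂ λ i j → ¬ SameCycle H (corner p i) (corner p j)

module _ {V : List Point} (H : TwoFactor V) (p : Point) where
  private
    c0 = corner p zero
    c1 = corner p (suc zero)
    c2 = corner p (suc (suc zero))
    c3 = corner p (suc (suc (suc zero)))

  Flippable : Set
  Flippable =
      (E H c0 c1 × E H c2 c3 × ¬ E H c1 c2 × ¬ E H c3 c0)
    ⊎ (E H c1 c2 × E H c3 c0 × ¬ E H c0 c1 × ¬ E H c2 c3)

  CriticalAt : Point → Point → Point → Point → Set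
  CriticalAt a b c d =
    SameCycle H a b × SameCycle H c d × ¬ SameCycle H a c
    × ((E H a b × ¬ E H c d) ⊎ (¬ E H a b × E H c d))

  CriticalBoundary : Set
  CriticalBoundary =
    CriticalAt c0 c1 c2 c3 ⊎ CriticalAt c1 c2 c3 c0
    ⊎ CriticalAt c2 c3 c0 c1 ⊎ CriticalAt c3 c0 c1 c2

  CornerAt : Point → Point → Point → Point → Set
  CornerAt v1 v2 v3 v4 =
    ¬ SameCycle H v1 v2 × SameCycle H v2 v3 × SameCycle H v3 v4
    × E H v2 v3 × E H v3 v4

  CornerBoundary : Set
  CornerBoundary =
    CornerAt c0 c1 c2 c3 ⊎ CornerAt c1 c2 c3 c0
    ⊎ CornerAt c2 c3 c0 c1 ⊎ CornerAt c3 c0 c1 c2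

-- Decide which of the four sides of a face f ∈ B(H) lie in H. Three or four sides put
-- all corners on one cycle, and two opposite sides make f flippable. Two adjacent
-- sides give a corner boundary square. If a side is missing together with both sides
-- meeting it, its two endpoints have degree 2 only through edges leaving f, so the
-- face beyond that side has two opposite sides in H; since it is not flippable, those
-- endpoints lie on one cycle. This turns a single side into a critical boundary
-- square, and excludes the case of no side at all.
module Submission where

open import Defs
open import Data.Empty using (⊥-elim)
open import Data.Fin using (zero; suc)
open import Data.Integer as ℤ using (ℤ; +_; -[1+_]; _+_; _-_; ∣_∣)
open import Data.Integer.Properties using (∣i∣≡0⇒i≡0; i-j≡0⇒i≡j)
open import Data.Integer.Tactic.RingSolver using (solve-∀)
open import Data.List using (List; []; _∷_; length; filter)
open import Data.List.Membership.Propositional using (_∈_; _∉_)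
open import Data.List.Membership.Propositional.Properties using (∈-filter⁺)
open import Data.List.Properties using (filter-notAll)
open import Data.List.Relation.Unary.All as All using (All; []; _∷_)
open import Data.List.Relation.Unary.Any as Any using (here; there)
open import Data.Nat using (zero; suc; _<_)
open import Data.Nat.Induction using (<-wellFounded)
open import Data.Nat.Properties using (suc-injective)
open import Data.Product using (∃; ∃₂; _×_; _,_; proj₁; proj₂)
open import Data.Product.Properties using (≡-dec)
open import Data.Sum using (_⊎_; inj₁; inj₂)
open import Function using (_∘_; case_of_)
open import Induction.WellFounded using (Acc; acc)
open import Relation.Binary.Construct.Closure.ReflexiveTransitive
  using (ε; _◅_; _◅◅_; reverse; return)
open import Relation.Binary.PropositionalEquality
  using (_≡_; refl; sym; trans; cong; cong₂; subst; subst₂)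
open import Relation.Nullary using (¬_; Dec; yes; no; ¬?)

_≟_ : (p q : Point) → Dec (p ≡ q)
_≟_ = ≡-dec ℤ._≟_ ℤ._≟_

open import Data.List.Membership.DecPropositional _≟_ using (_∈?_)

right left up down : Point → Point
right (x , y) = (x + + 1 , y)
left  (x , y) = (x - + 1 , y)
up    (x , y) = (x , y + + 1)
down  (x , y) = (x , y - + 1)

i+1-1≡i : ∀ i → i + + 1 - + 1 ≡ i
i+1-1≡i = solve-∀

i-1+1≡i : ∀ i → i - + 1 + + 1 ≡ i
i-1+1≡i = solve-∀

i-[i-j]≡j : ∀ i j → i - (i - j) ≡ j
i-[i-j]≡j = solve-∀

left-right : ∀ p → left (right p) ≡ p
left-right (x , y) = cong (_, y) (i+1-1≡i x)

right-left : ∀ p → right (left p) ≡ p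
right-left (x , y) = cong (_, y) (i-1+1≡i x)

down-up : ∀ p → down (up p) ≡ p
down-up (x , y) = cong (x ,_) (i+1-1≡i y)

up-down : ∀ p → up (down p) ≡ p
up-down (x , y) = cong (x ,_) (i-1+1≡i y)

coordinate-same : ∀ a a' → ∣ a - a' ∣ ≡ 0 → a' ≡ a
coordinate-same a a' d = sym (i-j≡0⇒i≡j a a' (∣i∣≡0⇒i≡0 d))

coordinate-step : ∀ a a' → ∣ a - a' ∣ ≡ 1 → a' ≡ a + + 1 ⊎ a' ≡ a - + 1
coordinate-step a a' d with a - a' in eq
... | + _      = inj₂ (trans (sym (i-[i-j]≡j a a')) (cong (a -_) (trans eq (cong +_ d))))
... | -[1+ _ ] = inj₁ (trans (sym (i-[i-j]≡j a a')) (cong (a -_) (trans eq (cong -[1+_] (suc-injective d)))))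

neighbours : ∀ {p q} → Adj p q → q ≡ right p ⊎ q ≡ left p ⊎ q ≡ up p ⊎ q ≡ down p
neighbours {a , b} {a' , b'} d with ∣ a - a' ∣ in dx | ∣ b - b' ∣ in dy
... | 1 | 0 with coordinate-step a a' dx
...   | inj₁ a'≡ = inj₁ (cong₂ _,_ a'≡ (coordinate-same b b' dy))
...   | inj₂ a'≡ = inj₂ (inj₁ (cong₂ _,_ a'≡ (coordinate-same b b' dy)))
neighbours {a , b} {a' , b'} d | 0 | 1 with coordinate-step b b' dy
...   | inj₁ b'≡ = inj₂ (inj₂ (inj₁ (cong₂ _,_ (coordinate-same a a' dx) b'≡)))
...   | inj₂ b'≡ = inj₂ (inj₂ (inj₂ (cong₂ _,_ (coordinate-same a a' dx) b'≡)))
neighbours () | 0 | 0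
neighbours () | 0 | suc (suc _)
neighbours () | 1 | suc _
neighbours () | suc (suc _) | _

module Cycles {V : List Point} (H : TwoFactor V) where

  infix 4 _∼_
  _∼_ : Point → Point → Set
  _∼_ = SameCycle H

  edge : ∀ {u v} → E H u v → u ∼ v
  edge = return

  ∼-sym : ∀ {u v} → u ∼ v → v ∼ u
  ∼-sym = reverse (E-sym H)

  ∼-∈ : ∀ {u v} → u ∈ V → u ∼ v → v ∈ V
  ∼-∈ u∈V ε       = u∈V
  ∼-∈ _   (e ◅ s) = ∼-∈ (proj₁ (proj₂ (E-inG H e))) s

  adjacent : ∀ {u v} → E H u v → Adj u v
  adjacent e = proj₂ (proj₂ (E-inG H e))

  E? : ∀ {u} → u ∈ V → ∀ v → Dec (E H u v)
  E? {u} u∈V v with deg2 H u u∈V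
  ... | a , b , _ , ea , eb , only with v ≟ a | v ≟ b
  ...   | yes refl | _        = yes ea
  ...   | no _     | yes refl = yes eb
  ...   | no v≢a   | no v≢b   = no λ e → case only v e of λ where
                                   (inj₁ v≡a) → v≢a v≡a
                                   (inj₂ v≡b) → v≢b v≡b

  both-edges : ∀ {c a b} → c ∈ V → (∀ {q} → E H c q → q ≡ a ⊎ q ≡ b) →
               E H c a × E H c b
  both-edges {c} c∈V within with deg2 H c c∈V
  ... | a' , b' , a'≢b' , ea' , eb' , _ with within ea' | within eb'
  ...   | inj₁ refl | inj₂ refl = ea' , eb'
  ...   | inj₂ refl | inj₁ refl = eb' , ea'
  ...   | inj₁ refl | inj₁ refl = ⊥-elim (a'≢b' refl)
  ...   | inj₂ refl | inj₂ refl = ⊥-elim (a'≢b' refl)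

  other-two-edges : ∀ {c n₁ n₂ n₃ n₄} → c ∈ V →
                    (∀ {q} → Adj c q → q ≡ n₁ ⊎ q ≡ n₂ ⊎ q ≡ n₃ ⊎ q ≡ n₄) →
                    ¬ E H c n₁ → ¬ E H c n₂ → E H c n₃ × E H c n₄
  other-two-edges c∈V around ¬e₁ ¬e₂ = both-edges c∈V λ e → case around (adjacent e) of λ where
    (inj₁ refl)        → ⊥-elim (¬e₁ e)
    (inj₂ (inj₁ refl)) → ⊥-elim (¬e₂ e)
    (inj₂ (inj₂ q≡))   → q≡

  Closed : List Point → Set
  Closed R = ∀ {x y} → x ∈ R → E H x y → y ∈ R

  closed-∼ : ∀ {R x y} → Closed R → x ∈ R → x ∼ y → y ∈ R
  closed-∼ closed x∈R ε       = x∈R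
  closed-∼ closed x∈R (e ◅ s) = closed-∼ closed (closed x∈R e) s

  exit-or-closed : ∀ R xs → All (_∈ V) xs →
                   (∃₂ λ x y → x ∈ xs × E H x y × y ∉ R) ⊎
                   (∀ {x y} → x ∈ xs → E H x y → y ∈ R)
  exit-or-closed R []       []           = inj₂ λ ()
  exit-or-closed R (x ∷ xs) (x∈V ∷ xs∈V) with deg2 H x x∈V
  ... | a , b , _ , ea , eb , only with a ∈? R | b ∈? R | exit-or-closed R xs xs∈V
  ...   | no a∉R | _      | _ = inj₁ (x , a , here refl , ea , a∉R)
  ...   | yes _  | no b∉R | _ = inj₁ (x , b , here refl , eb , b∉R)
  ...   | yes _  | yes _  | inj₁ (x' , y , x'∈ , e , y∉R) = inj₁ (x' , y , there x'∈ , e , y∉R)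
  ...   | yes a∈R | yes b∈R | inj₂ rest = inj₂ λ where
          (here refl) e → case only _ e of λ where
            (inj₁ refl) → a∈R
            (inj₂ refl) → b∈R
          (there x'∈) e → rest x'∈ e

  module Component {u} (u∈V : u ∈ V) where

    grow : ∀ R U → Acc _<_ (length U) → u ∈ R → All (u ∼_) R →
           (∀ {v} → v ∈ V → v ∈ R ⊎ v ∈ U) →
           ∃ λ C → u ∈ C × All (u ∼_) C × Closed C
    grow R U (acc smaller) u∈R R∼ cover with exit-or-closed R R (All.map (∼-∈ u∈V) R∼)
    ... | inj₂ closed = R , u∈R , R∼ , closed
    ... | inj₁ (x , y , x∈R , e , y∉R) =
          grow (y ∷ R) U' (smaller shrinks) (there u∈R) ((All.lookup R∼ x∈R ◅◅ edge e) ∷ R∼) cover'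
      where
        U' : List Point
        U' = filter (¬? ∘ (_≟ y)) U

        y∈U : y ∈ U
        y∈U with cover (∼-∈ u∈V (All.lookup R∼ x∈R ◅◅ edge e))
        ... | inj₁ y∈R = ⊥-elim (y∉R y∈R)
        ... | inj₂ y∈U = y∈U

        shrinks : length U' < length U
        shrinks = filter-notAll (¬? ∘ (_≟ y)) U (Any.map (λ y≡z z≢y → z≢y (sym y≡z)) y∈U)

        cover' : ∀ {v} → v ∈ V → v ∈ y ∷ R ⊎ v ∈ U'
        cover' {v} v∈V with cover v∈V
        ... | inj₁ v∈R = inj₁ (there v∈R)
        ... | inj₂ v∈U with v ≟ y
        ...   | yes refl = inj₁ (here refl)
        ...   | no v≢y   = inj₂ (∈-filter⁺ (¬? ∘ (_≟ y)) v∈U v≢y)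

    cycle : ∃ λ C → u ∈ C × All (u ∼_) C × Closed C
    cycle = grow (u ∷ []) V (<-wellFounded _) (here refl) (ε ∷ []) inj₂

  ∼-dec : ∀ {u} → u ∈ V → ∀ v → Dec (u ∼ v)
  ∼-dec u∈V v with Component.cycle u∈V
  ... | C , u∈C , C∼ , closed with v ∈? C
  ...   | yes v∈C = yes (All.lookup C∼ v∈C)
  ...   | no v∉C  = no (v∉C ∘ closed-∼ closed u∈C)

  Separated : Point → Point → Point → Point → Set
  Separated a b c d = ¬ (a ∼ b × b ∼ c × c ∼ d)

  separated-rotate : ∀ {a b c d} → Separated a b c d → Separated b c d a
  separated-rotate sep (b∼c , c∼d , d∼a) = sep (∼-sym (b∼c ◅◅ c∼d ◅◅ d∼a) , b∼c , c∼d)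

  corner-at : ∀ p {a b c d} → Separated a b c d → E H b c → E H c d → CornerAt H p a b c d
  corner-at _ sep e₁ e₂ = (λ s → sep (s , edge e₁ , edge e₂)) , edge e₁ , edge e₂ , e₁ , e₂

  critical-at : ∀ p {a b c d} → Separated a b c d → a ∼ b → ¬ E H a b → E H c d →
                CriticalAt H p a b c d
  critical-at _ sep a∼b n e =
    a∼b , edge e , (λ a∼c → sep (a∼b , ∼-sym a∼b ◅◅ a∼c , edge e)) , inj₂ (n , e)

module _ {V : List Point} (H : TwoFactor V)
         (no-flips : ∀ p → SquareFace V p → InB H p → ¬ Flippable H p) where

  open Cycles H

  k₀ k₁ k₂ k₃ : Point → Point
  k₀ p = corner p zero
  k₁ p = corner p (suc zero)
  k₂ p = corner p (suc (suc zero))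
  k₃ p = corner p (suc (suc (suc zero)))

  -- A face with two opposite sides in H that is not flippable cannot lie in B(H),
  -- so its other two sides join vertices of one cycle.
  vertical-sides : ∀ q → SquareFace V q → E H (k₁ q) (k₂ q) → E H (k₃ q) (k₀ q) →
                   k₀ q ∼ k₁ q × k₃ q ∼ k₂ q
  vertical-sides q face e₁₂ e₃₀ with ∼-dec (face zero) (k₁ q)
  ... | yes s = s , e₃₀ ◅ s ◅◅ edge e₁₂
  ... | no ¬s = ⊥-elim (no-flips q face (zero , suc zero , ¬s)
                  (inj₂ (e₁₂ , e₃₀ , ¬s ∘ edge ,
                         λ e₂₃ → ¬s (E-sym H e₃₀ ◅ E-sym H e₂₃ ◅ E-sym H e₁₂ ◅ ε))))

  horizontal-sides : ∀ q → SquareFace V q → E H (k₀ q) (k₁ q) → E H (k₂ q) (k₃ q) →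
                     k₀ q ∼ k₃ q × k₁ q ∼ k₂ q
  horizontal-sides q face e₀₁ e₂₃ with ∼-dec (face zero) (k₃ q)
  ... | yes s = s , ∼-sym (edge e₀₁) ◅◅ s ◅◅ ∼-sym (edge e₂₃)
  ... | no ¬s = ⊥-elim (no-flips q face (zero , suc (suc (suc zero)) , ¬s)
                  (inj₁ (e₀₁ , e₂₃ , (λ e₁₂ → ¬s (e₀₁ ◅ e₁₂ ◅ e₂₃ ◅ ε)) ,
                         ¬s ∘ edge ∘ E-sym H)))

  module Face (x y : ℤ) (face : SquareFace V (x , y)) (inB : InB H (x , y)) where

    c₀ c₁ c₂ c₃ : Point
    c₀ = (x , y)
    c₁ = right c₀
    c₂ = up c₁
    c₃ = up c₀

    neighbours₀ : ∀ {q} → Adj c₀ q → q ≡ c₁ ⊎ q ≡ c₃ ⊎ q ≡ left c₀ ⊎ q ≡ down c₀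
    neighbours₀ a with neighbours a
    ... | inj₁ q≡               = inj₁ q≡
    ... | inj₂ (inj₁ q≡)        = inj₂ (inj₂ (inj₁ q≡))
    ... | inj₂ (inj₂ (inj₁ q≡)) = inj₂ (inj₁ q≡)
    ... | inj₂ (inj₂ (inj₂ q≡)) = inj₂ (inj₂ (inj₂ q≡))

    neighbours₁ : ∀ {q} → Adj c₁ q → q ≡ c₀ ⊎ q ≡ c₂ ⊎ q ≡ right c₁ ⊎ q ≡ down c₁
    neighbours₁ a with neighbours a
    ... | inj₁ q≡               = inj₂ (inj₂ (inj₁ q≡))
    ... | inj₂ (inj₁ q≡)        = inj₁ (trans q≡ (left-right c₀))
    ... | inj₂ (inj₂ (inj₁ q≡)) = inj₂ (inj₁ q≡)
    ... | inj₂ (inj₂ (inj₂ q≡)) = inj₂ (inj₂ (inj₂ q≡))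

    neighbours₂ : ∀ {q} → Adj c₂ q → q ≡ c₁ ⊎ q ≡ c₃ ⊎ q ≡ right c₂ ⊎ q ≡ up c₂
    neighbours₂ a with neighbours a
    ... | inj₁ q≡               = inj₂ (inj₂ (inj₁ q≡))
    ... | inj₂ (inj₁ q≡)        = inj₂ (inj₁ (trans q≡ (left-right c₃)))
    ... | inj₂ (inj₂ (inj₁ q≡)) = inj₂ (inj₂ (inj₂ q≡))
    ... | inj₂ (inj₂ (inj₂ q≡)) = inj₁ (trans q≡ (down-up c₁))

    neighbours₃ : ∀ {q} → Adj c₃ q → q ≡ c₀ ⊎ q ≡ c₂ ⊎ q ≡ left c₃ ⊎ q ≡ up c₃
    neighbours₃ a with neighbours a
    ... | inj₁ q≡               = inj₂ (inj₁ q≡)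
    ... | inj₂ (inj₁ q≡)        = inj₂ (inj₂ (inj₁ q≡))
    ... | inj₂ (inj₂ (inj₁ q≡)) = inj₂ (inj₂ (inj₂ q≡))
    ... | inj₂ (inj₂ (inj₂ q≡)) = inj₁ (trans q≡ (down-up c₀))

    outward₀ : ¬ E H c₃ c₀ → ¬ E H c₀ c₁ → E H c₀ (left c₀) × E H c₀ (down c₀)
    outward₀ n₃ n₀ = other-two-edges (face zero) neighbours₀ n₀ (n₃ ∘ E-sym H)

    outward₁ : ¬ E H c₀ c₁ → ¬ E H c₁ c₂ → E H c₁ (right c₁) × E H c₁ (down c₁)
    outward₁ n₀ n₁ = other-two-edges (face (suc zero)) neighbours₁ (n₀ ∘ E-sym H) n₁

    outward₂ : ¬ E H c₁ c₂ → ¬ E H c₂ c₃ → E H c₂ (right c₂) × E H c₂ (up c₂)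
    outward₂ n₁ n₂ = other-two-edges (face (suc (suc zero))) neighbours₂ (n₁ ∘ E-sym H) n₂

    outward₃ : ¬ E H c₂ c₃ → ¬ E H c₃ c₀ → E H c₃ (left c₃) × E H c₃ (up c₃)
    outward₃ n₂ n₃ = other-two-edges (face (suc (suc (suc zero)))) neighbours₃ n₃ (n₂ ∘ E-sym H)

    linked-below : ¬ E H c₃ c₀ → ¬ E H c₀ c₁ → ¬ E H c₁ c₂ → c₀ ∼ c₁
    linked-below n₃ n₀ n₁ =
      subst₂ _∼_ (up-down c₀) (up-down c₁) (proj₂ (vertical-sides (down c₀) face' e₁₂ e₃₀))
      where
        d₀ = proj₂ (outward₀ n₃ n₀)
        d₁ = proj₂ (outward₁ n₀ n₁)
        face' : SquareFace V (down c₀)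
        face' zero                   = ∼-∈ (face zero) (edge d₀)
        face' (suc zero)             = ∼-∈ (face (suc zero)) (edge d₁)
        face' (suc (suc zero))       = subst (_∈ V) (sym (up-down c₁)) (face (suc zero))
        face' (suc (suc (suc zero))) = subst (_∈ V) (sym (up-down c₀)) (face zero)
        e₁₂ : E H (down c₁) (up (down c₁))
        e₁₂ = subst (E H (down c₁)) (sym (up-down c₁)) (E-sym H d₁)
        e₃₀ : E H (up (down c₀)) (down c₀)
        e₃₀ = subst (λ z → E H z (down c₀)) (sym (up-down c₀)) d₀

    linked-right : ¬ E H c₀ c₁ → ¬ E H c₁ c₂ → ¬ E H c₂ c₃ → c₁ ∼ c₂
    linked-right n₀ n₁ n₂ =
      proj₁ (horizontal-sides c₁ face' (proj₁ (outward₁ n₀ n₁)) (E-sym H (proj₁ (outward₂ n₁ n₂))))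
      where
        face' : SquareFace V c₁
        face' zero                   = face (suc zero)
        face' (suc zero)             = ∼-∈ (face (suc zero)) (edge (proj₁ (outward₁ n₀ n₁)))
        face' (suc (suc zero))       = ∼-∈ (face (suc (suc zero))) (edge (proj₁ (outward₂ n₁ n₂)))
        face' (suc (suc (suc zero))) = face (suc (suc zero))

    linked-above : ¬ E H c₁ c₂ → ¬ E H c₂ c₃ → ¬ E H c₃ c₀ → c₂ ∼ c₃
    linked-above n₁ n₂ n₃ =
      ∼-sym (proj₁ (vertical-sides c₃ face' (proj₂ (outward₂ n₁ n₂)) (E-sym H (proj₂ (outward₃ n₂ n₃)))))
      where
        face' : SquareFace V c₃
        face' zero                   = face (suc (suc (suc zero)))
        face' (suc zero)             = face (suc (suc zero))
        face' (suc (suc zero))       = ∼-∈ (face (suc (suc zero))) (edge (proj₂ (outward₂ n₁ n₂)))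
        face' (suc (suc (suc zero))) = ∼-∈ (face (suc (suc (suc zero)))) (edge (proj₂ (outward₃ n₂ n₃)))

    linked-left : ¬ E H c₂ c₃ → ¬ E H c₃ c₀ → ¬ E H c₀ c₁ → c₃ ∼ c₀
    linked-left n₂ n₃ n₀ =
      ∼-sym (subst₂ _∼_ (right-left c₀) (right-left c₃) (proj₂ (horizontal-sides (left c₀) face' e₀₁ e₂₃)))
      where
        l₀ = proj₁ (outward₀ n₃ n₀)
        l₃ = proj₁ (outward₃ n₂ n₃)
        face' : SquareFace V (left c₀)
        face' zero                   = ∼-∈ (face zero) (edge l₀)
        face' (suc zero)             = subst (_∈ V) (sym (right-left c₀)) (face zero)
        face' (suc (suc zero))       = subst (_∈ V) (sym (right-left c₃)) (face (suc (suc (suc zero))))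
        face' (suc (suc (suc zero))) = ∼-∈ (face (suc (suc (suc zero)))) (edge l₃)
        e₀₁ : E H (left c₀) (right (left c₀))
        e₀₁ = subst (E H (left c₀)) (sym (right-left c₀)) (E-sym H l₀)
        e₂₃ : E H (right (left c₃)) (left c₃)
        e₂₃ = subst (λ z → E H z (left c₃)) (sym (right-left c₃)) l₃

    separated₀ : Separated c₀ c₁ c₂ c₃
    separated₀ (s₀₁ , s₁₂ , s₂₃) = proj₂ (proj₂ inB) (∼-sym (from-c₀ (proj₁ inB)) ◅◅ from-c₀ (proj₁ (proj₂ inB)))
      where
        from-c₀ : ∀ k → c₀ ∼ corner (x , y) k
        from-c₀ zero                   = ε
        from-c₀ (suc zero)             = s₀₁
        from-c₀ (suc (suc zero))       = s₀₁ ◅◅ s₁₂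
        from-c₀ (suc (suc (suc zero))) = s₀₁ ◅◅ s₁₂ ◅◅ s₂₃

    separated₁ : Separated c₁ c₂ c₃ c₀
    separated₁ = separated-rotate separated₀

    separated₂ : Separated c₂ c₃ c₀ c₁
    separated₂ = separated-rotate separated₁

    separated₃ : Separated c₃ c₀ c₁ c₂
    separated₃ = separated-rotate separated₂

    classify : CriticalBoundary H (x , y) ⊎ CornerBoundary H (x , y)
    classify with E? (face zero) c₁ | E? (face (suc zero)) c₂
                | E? (face (suc (suc zero))) c₃ | E? (face (suc (suc (suc zero)))) c₀
    ... | yes e₀ | yes e₁ | yes e₂ | _      = ⊥-elim (separated₀ (edge e₀ , edge e₁ , edge e₂))
    ... | yes e₀ | yes e₁ | no _   | yes e₃ = ⊥-elim (separated₃ (edge e₃ , edge e₀ , edge e₁))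
    ... | yes e₀ | no _   | yes e₂ | yes e₃ = ⊥-elim (separated₂ (edge e₂ , edge e₃ , edge e₀))
    ... | no _   | yes e₁ | yes e₂ | yes e₃ = ⊥-elim (separated₁ (edge e₁ , edge e₂ , edge e₃))
    ... | yes e₀ | no n₁  | yes e₂ | no n₃  = ⊥-elim (no-flips (x , y) face inB (inj₁ (e₀ , e₂ , n₁ , n₃)))
    ... | no n₀  | yes e₁ | no n₂  | yes e₃ = ⊥-elim (no-flips (x , y) face inB (inj₂ (e₁ , e₃ , n₀ , n₂)))
    ... | no _   | yes e₁ | yes e₂ | no _   = inj₂ (inj₁ (corner-at (x , y) separated₀ e₁ e₂))
    ... | no _   | no _   | yes e₂ | yes e₃ = inj₂ (inj₂ (inj₁ (corner-at (x , y) separated₁ e₂ e₃)))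
    ... | yes e₀ | no _   | no _   | yes e₃ = inj₂ (inj₂ (inj₂ (inj₁ (corner-at (x , y) separated₂ e₃ e₀))))
    ... | yes e₀ | yes e₁ | no _   | no _   = inj₂ (inj₂ (inj₂ (inj₂ (corner-at (x , y) separated₃ e₀ e₁))))
    ... | no n₀  | no n₁  | yes e₂ | no n₃  =
          inj₁ (inj₁ (critical-at (x , y) separated₀ (linked-below n₃ n₀ n₁) n₀ e₂))
    ... | no n₀  | no n₁  | no n₂  | yes e₃ =
          inj₁ (inj₂ (inj₁ (critical-at (x , y) separated₁ (linked-right n₀ n₁ n₂) n₁ e₃)))
    ... | yes e₀ | no n₁  | no n₂  | no n₃  =
          inj₁ (inj₂ (inj₂ (inj₁ (critical-at (x , y) separated₂ (linked-above n₁ n₂ n₃) n₂ e₀))))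
    ... | no n₀  | yes e₁ | no n₂  | no n₃  =
          inj₁ (inj₂ (inj₂ (inj₂ (critical-at (x , y) separated₃ (linked-left n₂ n₃ n₀) n₃ e₁))))
    ... | no n₀  | no n₁  | no n₂  | no n₃  =
          ⊥-elim (separated₀ (linked-below n₃ n₀ n₁ , linked-right n₀ n₁ n₂ , linked-above n₁ n₂ n₃))

-- The argument only looks at f and its four neighbouring faces.
mainTheorem3 : (V : List Point) → TwoConnected V → (H : TwoFactor V) →
               (∀ p → SquareFace V p → InB H p → ¬ Flippable H p) →
               ∀ p → SquareFace V p → InB H p →
               CriticalBoundary H p ⊎ CornerBoundary H p
mainTheorem3 V _ H no-flips (x , y) face inB = Face.classify H no-flips x y face inB
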